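{- Let $G$ be a spider with $d\ge 3$ legs such that at least one leg has length $1$. Then $\chi_{la}(G)=d+1$.
   Context: All graphs are finite, simple and connected. For a graph $G=(V,E)$ with $q=|E|$ edges, a local antimagic labeling of $G$ is a bijection $f:E\to\{1,\dots,q\}$ such that $f^+(x)\ne f^+(y)$ for every pair of adjacent vertices $x,y$, where $f^+(x)=\sum_{e\ni x} f(e)$. The local antimagic chromatic number $\chi_{la}(G)$ is the minimum, over all local antimagic labelings $f$ of $G$, of the number of distinct values taken by $f^+$. For $d\ge 3$ and integers $y_1,\dots,y_d\ge 1$, the spider $Sp(y_1,\dots,y_d)$ (a spider with $d$ legs) is the tree obtained from $d$ paths of lengths (numbers of edges) $y_1,\dots,y_d$ by identifying one end-vertex of each path into a single vertex (the core); these paths are its legs. -}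

module Defs where

open import Data.Nat using (ℕ; zero; suc; _+_; _≤_)
open import Data.Nat.Properties using (_≟_)
open import Data.Fin using (Fin; toℕ)
open import Data.List using (List; []; _∷_; _++_; length; map; upTo; allFin; lookup; deduplicate)
open import Data.Nat.ListAction using (sum)
open import Data.Product using (_×_; _,_; proj₁; proj₂; Σ)
open import Data.Bool using (if_then_else_)
open import Relation.Nullary using (¬_)
open import Relation.Nullary.Decidable using (⌊_⌋)
open import Relation.Binary.PropositionalEquality using (_≡_)
open import Function.Definitions using (Bijective)

-- A finite graph: vertices are the naturals 0 … n-1, edges are indexed by Fin m,
-- edge e joins the two endpoints  ends e.
record Graph : Set where
  field
    n    : ℕ
    m    : ℕ
    ends : Fin m → ℕ × ℕ
open Graph public

-- An edge labeling is a map Fin m → Fin m; edge e receives the label 1 + toℕ (f e).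
-- It is a bijection onto {1,…,m} iff f is bijective.
Labeling : Graph → Set
Labeling G = Fin (m G) → Fin (m G)

label : (G : Graph) → Labeling G → Fin (m G) → ℕ
label G f e = suc (toℕ (f e))

vsum : (G : Graph) → Labeling G → ℕ → ℕ
vsum G f v = sum (map contrib (allFin (m G)))
  where
  contrib : Fin (m G) → ℕ
  contrib e = if ⌊ proj₁ (ends G e) ≟ v ⌋ then label G f e
              else (if ⌊ proj₂ (ends G e) ≟ v ⌋ then label G f e else 0)

IsLocalAntimagic : (G : Graph) → Labeling G → Set
IsLocalAntimagic G f =
  Bijective _≡_ _≡_ f ×
  ((e : Fin (m G)) → ¬ (vsum G f (proj₁ (ends G e)) ≡ vsum G f (proj₂ (ends G e))))

numColours : (G : Graph) → Labeling G → ℕ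
numColours G f = length (deduplicate _≟_ (map (vsum G f) (upTo (n G))))

LocalAntimagicChromaticNumber : Graph → ℕ → Set
LocalAntimagicChromaticNumber G k =
  (Σ (Labeling G) λ f → IsLocalAntimagic G f × numColours G f ≡ k) ×
  ((f : Labeling G) → IsLocalAntimagic G f → k ≤ numColours G f)

-- Spider: core is vertex 0; legs occupy consecutive blocks of vertices 1,2,…
-- legEdges prev k next : a path of k edges prev–next–(next+1)–…
legEdges : ℕ → ℕ → ℕ → List (ℕ × ℕ)
legEdges prev zero    next = []
legEdges prev (suc k) next = (prev , next) ∷ legEdges next k (suc next)

spiderEdges : List ℕ → ℕ → List (ℕ × ℕ)
spiderEdges []       next = []
spiderEdges (y ∷ ys) next = legEdges 0 y next ++ spiderEdges ys (next + y)

spider : List ℕ → Graph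
spider ys = record
  { n    = suc (sum ys)
  ; m    = length (spiderEdges ys 1)
  ; ends = lookup (spiderEdges ys 1)
  }

-- Number the edges 0, …, q − 1 leg by leg; edge i joins vertex i + 1 to vertex i, or to the core 0 when
-- it is the first edge of a leg, and the sum at a leaf is the label of its pendant edge.
-- Lower bound: under a bijective labelling the d leaves carry d distinct sums, each at most q, while the
-- edge labelled q lies at the core or at an internal vertex, whose sum therefore exceeds q.
-- Upper bound: give label q to the edge e of a leg of length 1 and label the other edges, from the last
-- one backwards, by q − 1, 1, q − 2, 2, …. Consecutive labels add up to q or q − 1, which are the leaf sums
-- at the ends of e and of the last edge other than e. So every internal sum is a leaf sum, the core sum
-- exceeds q, and adjacent internal vertices get different sums because the labelling is injective.

module Submission where

open import Defs
open import Data.Nat using (ℕ; zero; suc; _+_; _∸_; _≤_; _<_; z≤n; z<s; s≤s; s≤s⁻¹; _<?_)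
open import Data.Nat.Properties
open import Data.Nat.ListAction using (sum)
open import Data.Fin using (Fin; toℕ; fromℕ; fromℕ<; punchOut) renaming (zero to fzero; suc to fsuc)
import Data.Fin.Properties as Fin
open import Data.List using (List; []; _∷_; _++_; length; map; lookup; tabulate; upTo)
open import Data.List.Properties using (length-++; length-map; length-removeAt′; map-tabulate)
open import Data.List.Membership.Propositional using (_∈_; _─_)
open import Data.List.Membership.Propositional.Properties
  using (∈-map⁺; ∈-map⁻; ∈-upTo⁺; ∈-upTo⁻; ∈-deduplicate⁺; ∈-deduplicate⁻)
open import Data.List.Relation.Binary.Subset.Propositional using (_⊆_)
open import Data.List.Relation.Unary.All using (All; []; _∷_)
import Data.List.Relation.Unary.All as All
open import Data.List.Relation.Unary.AllPairs using ([]; _∷_)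
open import Data.List.Relation.Unary.Any using (here; there; index)
open import Data.List.Relation.Unary.Unique.Propositional using (Unique)
open import Data.List.Relation.Unary.Unique.DecPropositional.Properties _≟_ using (deduplicate-!)
open import Data.Product using (_×_; _,_; proj₁; proj₂; ∃)
open import Data.Sum using (_⊎_; inj₁; inj₂; [_,_])
import Data.Sum as Sum
open import Data.Bool using (Bool; true; false; if_then_else_; _∨_)
import Data.Bool as Bool
open import Data.Bool.Properties using (∨-zeroʳ; ¬-not)
open import Data.Unit using (⊤; tt)
open import Data.Empty using (⊥-elim)
open import Relation.Binary.PropositionalEquality hiding ([_])
open import Relation.Nullary using (¬_; contradiction; does; yes; no)
open import Relation.Nullary.Decidable using (⌊_⌋; dec-true; dec-false)
open import Function using (_∘_; id)
open import Function.Definitions using (Injective; Surjective; Bijective)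

sum-tabulate-zero : ∀ {n} (h : Fin n → ℕ) → (∀ e → h e ≡ 0) → sum (tabulate h) ≡ 0
sum-tabulate-zero {zero}  h h≡0 = refl
sum-tabulate-zero {suc n} h h≡0 = cong₂ _+_ (h≡0 fzero) (sum-tabulate-zero (h ∘ fsuc) (h≡0 ∘ fsuc))

sum-tabulate-single : ∀ {n} (h : Fin n → ℕ) e₀ → (∀ e → e ≢ e₀ → h e ≡ 0) →
                      sum (tabulate h) ≡ h e₀
sum-tabulate-single {suc n} h fzero     h≡0 =
  trans (cong (h fzero +_) (sum-tabulate-zero (h ∘ fsuc) (λ e → h≡0 (fsuc e) λ ()))) (+-identityʳ _)
sum-tabulate-single {suc n} h (fsuc e₀) h≡0 =
  cong₂ _+_ (h≡0 fzero λ ())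
    (sum-tabulate-single (h ∘ fsuc) e₀ (λ e e≢e₀ → h≡0 (fsuc e) (e≢e₀ ∘ Fin.suc-injective)))

sum-tabulate-pair : ∀ {n} (h : Fin n → ℕ) {e₀ e₁} → e₀ ≢ e₁ → (∀ e → e ≢ e₀ → e ≢ e₁ → h e ≡ 0) →
                    sum (tabulate h) ≡ h e₀ + h e₁
sum-tabulate-pair {suc n} h {fzero}   {fzero}   e₀≢e₁ h≡0 = contradiction refl e₀≢e₁
sum-tabulate-pair {suc n} h {fzero}   {fsuc e₁} e₀≢e₁ h≡0 =
  cong (h fzero +_)
    (sum-tabulate-single (h ∘ fsuc) e₁ (λ e e≢e₁ → h≡0 (fsuc e) (λ ()) (e≢e₁ ∘ Fin.suc-injective)))
sum-tabulate-pair {suc n} h {fsuc e₀} {fzero}   e₀≢e₁ h≡0 =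
  trans (cong (h fzero +_)
          (sum-tabulate-single (h ∘ fsuc) e₀ (λ e e≢e₀ → h≡0 (fsuc e) (e≢e₀ ∘ Fin.suc-injective) (λ ()))))
        (+-comm (h fzero) _)
sum-tabulate-pair {suc n} h {fsuc e₀} {fsuc e₁} e₀≢e₁ h≡0 =
  cong₂ _+_ (h≡0 fzero (λ ()) (λ ()))
    (sum-tabulate-pair (h ∘ fsuc) (e₀≢e₁ ∘ cong fsuc)
      (λ e e≢e₀ e≢e₁ → h≡0 (fsuc e) (e≢e₀ ∘ Fin.suc-injective) (e≢e₁ ∘ Fin.suc-injective)))

≤-sum-tabulate : ∀ {n} (h : Fin n → ℕ) e → h e ≤ sum (tabulate h)
≤-sum-tabulate {suc n} h fzero    = m≤m+n _ _
≤-sum-tabulate {suc n} h (fsuc e) = ≤-trans (≤-sum-tabulate (h ∘ fsuc) e) (m≤n+m _ _)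

pair-≤-sum-tabulate : ∀ {n} (h : Fin n → ℕ) {e₀ e₁} → e₀ ≢ e₁ → h e₀ + h e₁ ≤ sum (tabulate h)
pair-≤-sum-tabulate {suc n} h {fzero}   {fzero}   e₀≢e₁ = contradiction refl e₀≢e₁
pair-≤-sum-tabulate {suc n} h {fzero}   {fsuc e₁} e₀≢e₁ =
  +-monoʳ-≤ (h fzero) (≤-sum-tabulate (h ∘ fsuc) e₁)
pair-≤-sum-tabulate {suc n} h {fsuc e₀} {fzero}   e₀≢e₁ =
  subst (_≤ sum (tabulate h)) (+-comm (h fzero) _) (+-monoʳ-≤ (h fzero) (≤-sum-tabulate (h ∘ fsuc) e₀))
pair-≤-sum-tabulate {suc n} h {fsuc e₀} {fsuc e₁} e₀≢e₁ =
  ≤-trans (pair-≤-sum-tabulate (h ∘ fsuc) (e₀≢e₁ ∘ cong fsuc)) (m≤n+m _ _)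

module _ (G : Graph) (f : Labeling G) where

  Incident : Fin (m G) → ℕ → Set
  Incident e v = proj₁ (ends G e) ≡ v ⊎ proj₂ (ends G e) ≡ v

  weight : ℕ → Fin (m G) → ℕ
  weight v e = if ⌊ proj₁ (ends G e) ≟ v ⌋ then label G f e
               else (if ⌊ proj₂ (ends G e) ≟ v ⌋ then label G f e else 0)

  vsum≡sum-weight : ∀ v → vsum G f v ≡ sum (tabulate (weight v))
  vsum≡sum-weight v = cong sum (map-tabulate id (weight v))

  weight-incident : ∀ {e v} → Incident e v → weight v e ≡ label G f e
  weight-incident {e} {v} incident with proj₁ (ends G e) ≟ v | proj₂ (ends G e) ≟ v | incident
  ... | yes _ | _     | _      = refl
  ... | no  _ | yes _ | _      = refl
  ... | no ¬a | no  _ | inj₁ a = contradiction a ¬a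
  ... | no  _ | no ¬b | inj₂ b = contradiction b ¬b

  weight-not-incident : ∀ {e v} → ¬ Incident e v → weight v e ≡ 0
  weight-not-incident {e} {v} ¬incident with proj₁ (ends G e) ≟ v | proj₂ (ends G e) ≟ v
  ... | yes a | _     = contradiction (inj₁ a) ¬incident
  ... | no  _ | yes b = contradiction (inj₂ b) ¬incident
  ... | no  _ | no  _ = refl

  vsum≡label : ∀ {e₀ v} → Incident e₀ v → (∀ e → Incident e v → e ≡ e₀) → vsum G f v ≡ label G f e₀
  vsum≡label {e₀} {v} incident only-e₀ = begin
    vsum G f v                ≡⟨ vsum≡sum-weight v ⟩
    sum (tabulate (weight v)) ≡⟨ sum-tabulate-single (weight v) e₀ not-incident ⟩
    weight v e₀               ≡⟨ weight-incident incident ⟩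
    label G f e₀              ∎
    where
    open ≡-Reasoning
    not-incident : ∀ e → e ≢ e₀ → weight v e ≡ 0
    not-incident e e≢e₀ = weight-not-incident (e≢e₀ ∘ only-e₀ e)

  vsum≡label+label : ∀ {e₀ e₁ v} → e₀ ≢ e₁ → Incident e₀ v → Incident e₁ v →
                     (∀ e → Incident e v → e ≡ e₀ ⊎ e ≡ e₁) → vsum G f v ≡ label G f e₀ + label G f e₁
  vsum≡label+label {e₀} {e₁} {v} e₀≢e₁ incident₀ incident₁ only-e₀e₁ = begin
    vsum G f v                  ≡⟨ vsum≡sum-weight v ⟩
    sum (tabulate (weight v))   ≡⟨ sum-tabulate-pair (weight v) e₀≢e₁ not-incident ⟩
    weight v e₀ + weight v e₁   ≡⟨ cong₂ _+_ (weight-incident incident₀) (weight-incident incident₁) ⟩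
    label G f e₀ + label G f e₁ ∎
    where
    open ≡-Reasoning
    not-incident : ∀ e → e ≢ e₀ → e ≢ e₁ → weight v e ≡ 0
    not-incident e e≢e₀ e≢e₁ = weight-not-incident ([ e≢e₀ , e≢e₁ ] ∘ only-e₀e₁ e)

  label+label≤vsum : ∀ {e₀ e₁ v} → e₀ ≢ e₁ → Incident e₀ v → Incident e₁ v →
                     label G f e₀ + label G f e₁ ≤ vsum G f v
  label+label≤vsum {e₀} {e₁} {v} e₀≢e₁ incident₀ incident₁ =
    subst₂ _≤_ (cong₂ _+_ (weight-incident incident₀) (weight-incident incident₁)) (sym (vsum≡sum-weight v))
      (pair-≤-sum-tabulate (weight v) e₀≢e₁)

  label-injective : Injective _≡_ _≡_ f → Injective _≡_ _≡_ (label G f)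
  label-injective f-injective eq = f-injective (Fin.toℕ-injective (suc-injective eq))

module _ {A : Set} where

  ∈-─ : ∀ {x y : A} {ys} (x∈ys : x ∈ ys) → y ∈ ys → y ≢ x → y ∈ ys ─ x∈ys
  ∈-─ (here refl)  (here refl)  y≢x = contradiction refl y≢x
  ∈-─ (here _)     (there y∈ys) _   = y∈ys
  ∈-─ (there _)    (here y≡z)   _   = here y≡z
  ∈-─ (there x∈ys) (there y∈ys) y≢x = there (∈-─ x∈ys y∈ys y≢x)

  Unique-⊆⇒length-≤ : ∀ {xs ys : List A} → Unique xs → xs ⊆ ys → length xs ≤ length ys
  Unique-⊆⇒length-≤ {[]}     _            _     = z≤n
  Unique-⊆⇒length-≤ {x ∷ xs} {ys} (x∉xs ∷ xs!) xs⊆ys =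
    subst (suc (length xs) ≤_) (sym (length-removeAt′ ys (index x∈ys))) (s≤s (Unique-⊆⇒length-≤ xs! xs⊆ys─x))
    where
    x∈ys : x ∈ ys
    x∈ys = xs⊆ys (here refl)
    xs⊆ys─x : xs ⊆ ys ─ x∈ys
    xs⊆ys─x y∈xs = ∈-─ x∈ys (xs⊆ys (there y∈xs)) (λ y≡x → All.lookup x∉xs y∈xs (sym y≡x))

  Unique-map⁺ : ∀ {g : A → ℕ} {xs} → (∀ {x y} → x ∈ xs → y ∈ xs → g x ≡ g y → x ≡ y) →
                Unique xs → Unique (map g xs)
  Unique-map⁺ {xs = []}     _   []           = []
  Unique-map⁺ {g} {x ∷ xs} inj (x∉xs ∷ xs!) =
    All.tabulate gx∉ ∷ Unique-map⁺ (λ x∈ y∈ → inj (there x∈) (there y∈)) xs!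
    where
    gx∉ : ∀ {z} → z ∈ map g xs → g x ≢ z
    gx∉ z∈ gx≡z with y , y∈xs , z≡gy ← ∈-map⁻ g z∈ =
      All.lookup x∉xs y∈xs (inj (here refl) (there y∈xs) (trans gx≡z z≡gy))

colours : (G : Graph) → Labeling G → List ℕ
colours G f = map (vsum G f) (upTo (n G))

length-≤-numColours : (G : Graph) (f : Labeling G) {us : List ℕ} →
                      Unique us → us ⊆ colours G f → length us ≤ numColours G f
length-≤-numColours G f us! us⊆ = Unique-⊆⇒length-≤ us! (∈-deduplicate⁺ _≟_ ∘ us⊆)

numColours-≤-length : (G : Graph) (f : Labeling G) {us : List ℕ} → colours G f ⊆ us → numColours G f ≤ length us
numColours-≤-length G f ⊆us =
  Unique-⊆⇒length-≤ (deduplicate-! (colours G f)) (⊆us ∘ ∈-deduplicate⁻ _≟_ (colours G f))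

injective⇒surjective : ∀ {n} (g : Fin n → Fin n) → Injective _≡_ _≡_ g → Surjective _≡_ _≡_ g
injective⇒surjective {suc n} g g-injective y with Fin.any? (λ x → g x Fin.≟ y)
... | yes (x , gx≡y) = x , λ { refl → gx≡y }
... | no  ∄x         = contradiction (Fin.injective⇒≤ h-injective) (1+n≰n {n})
  where
  h : Fin (suc n) → Fin n
  h x = punchOut {i = y} {j = g x} (λ y≡gx → ∄x (x , sym y≡gx))
  h-injective : Injective _≡_ _≡_ h
  h-injective {a} {b} eq =
    g-injective (Fin.punchOut-injective (λ y≡ga → ∄x (a , sym y≡ga)) (λ y≡gb → ∄x (b , sym y≡gb)) eq)

surjective-hits-top : ∀ {n} (g : Fin n → Fin n) → Surjective _≡_ _≡_ g → 0 < n → ∃ λ e → suc (toℕ (g e)) ≡ n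
surjective-hits-top {suc n} g surj _ with e , ge≡top ← surj (fromℕ n) =
  e , cong suc (trans (cong toℕ (ge≡top refl)) (Fin.toℕ-fromℕ n))

-- Zigzag labellings

-- N, 0, N ∸ 1, 1, N ∸ 2, 2, …; entries past index N are junk.
zigzag : ℕ → ℕ → ℕ
zigzag N       zero    = N
zigzag zero    (suc r) = 0
zigzag (suc M) (suc r) = M ∸ zigzag M r

zigzag-≤ : ∀ N r → zigzag N r ≤ N
zigzag-≤ N       zero    = ≤-refl
zigzag-≤ zero    (suc r) = z≤n
zigzag-≤ (suc M) (suc r) = ≤-trans (m∸n≤m M (zigzag M r)) (n≤1+n M)

zigzag-suc-< : ∀ M r → zigzag (suc M) (suc r) < zigzag (suc M) zero
zigzag-suc-< M r = s≤s (m∸n≤m M (zigzag M r))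

zigzag-injective : ∀ N {r s} → r ≤ N → s ≤ N → zigzag N r ≡ zigzag N s → r ≡ s
zigzag-injective N       {zero}  {zero}  _ _ _ = refl
zigzag-injective (suc M) {zero}  {suc s} _ _ eq = contradiction (sym eq) (<⇒≢ (zigzag-suc-< M s))
zigzag-injective (suc M) {suc r} {zero}  _ _ eq = contradiction eq (<⇒≢ (zigzag-suc-< M r))
zigzag-injective (suc M) {suc r} {suc s} (s≤s r≤M) (s≤s s≤M) eq =
  cong suc (zigzag-injective M r≤M s≤M (∸-cancelˡ-≡ (zigzag-≤ M r) (zigzag-≤ M s) eq))

_⊕_≈_ : ℕ → ℕ → ℕ → Set
x ⊕ y ≈ N = x + y ≡ N ⊎ suc (x + y) ≡ N

⊕-comm : ∀ {x y N} → x ⊕ y ≈ N → y ⊕ x ≈ N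
⊕-comm {x} {y} (inj₁ eq) = inj₁ (trans (+-comm y x) eq)
⊕-comm {x} {y} (inj₂ eq) = inj₂ (trans (cong suc (+-comm y x)) eq)

complements-≈ : ∀ {a b M} → a ⊕ b ≈ M → (M ∸ a) ⊕ (M ∸ b) ≈ suc M
complements-≈ {a} {b} (inj₁ refl) = inj₂ (cong suc (begin
  a + b ∸ a + (a + b ∸ b) ≡⟨ cong₂ _+_ (m+n∸m≡n a b) (m+n∸n≡m a b) ⟩
  b + a                   ≡⟨ +-comm b a ⟩
  a + b                   ∎))
  where open ≡-Reasoning
complements-≈ {a} {b} (inj₂ refl) = inj₁ (begin
  suc (a + b) ∸ a + (suc (a + b) ∸ b) ≡⟨ cong₂ _+_ (+-∸-assoc 1 (m≤m+n a b)) (+-∸-assoc 1 (m≤n+m b a)) ⟩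
  suc (a + b ∸ a) + suc (a + b ∸ b)   ≡⟨ cong₂ (λ x y → suc x + suc y) (m+n∸m≡n a b) (m+n∸n≡m a b) ⟩
  suc b + suc a                       ≡⟨ cong suc (+-suc b a) ⟩
  suc (suc (b + a))                   ≡⟨ cong (suc ∘ suc) (+-comm b a) ⟩
  suc (suc (a + b))                   ∎)
  where open ≡-Reasoning

zigzag-pairs : ∀ N r → suc r ≤ N → zigzag N r ⊕ zigzag N (suc r) ≈ N
zigzag-pairs (suc M) zero    _         = inj₁ (trans (cong (suc M +_) (n∸n≡0 M)) (+-identityʳ (suc M)))
zigzag-pairs (suc M) (suc r) (s≤s r<M) =
  complements-≈ {zigzag M r} {zigzag M (suc r)} (zigzag-pairs M r r<M)

module SkipLabeling (N P : ℕ) (P≤1+N : P ≤ suc N) where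

  -- Edges other than P, counted from the last one: ranks N, N ∸ 1, …, 0.
  rank : ℕ → ℕ
  rank i = if ⌊ i <? P ⌋ then N ∸ i else suc N ∸ i

  rank-< : ∀ {i} → i < P → rank i ≡ N ∸ i
  rank-< {i} i<P with i <? P
  ... | yes _   = refl
  ... | no  i≮P = contradiction i<P i≮P

  rank-≮ : ∀ {i} → ¬ i < P → rank i ≡ suc N ∸ i
  rank-≮ {i} i≮P with i <? P
  ... | yes i<P = contradiction i<P i≮P
  ... | no  _   = refl

  rank-≤ : ∀ {i} → i ≢ P → rank i ≤ N
  rank-≤ {i} i≢P with i <? P
  ... | yes _ = m∸n≤m N i
  rank-≤ {zero}  i≢P | no i≮P = contradiction (sym (n≤0⇒n≡0 (≮⇒≥ i≮P))) i≢P
  rank-≤ {suc i} i≢P | no _   = m∸n≤m N i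

  private
    before≢after : ∀ {i j} → i < P → P < j → j ≤ suc N → N ∸ i ≢ suc N ∸ j
    before≢after {i} {j} i<P P<j j≤1+N eq = <-irrefl (sym eq) (begin-strict
      suc N ∸ j ≤⟨ ∸-monoʳ-≤ (suc N) 2+i≤j ⟩
      N ∸ suc i <⟨ ∸-monoʳ-< (n<1+n i) (s≤s⁻¹ (≤-trans 2+i≤j j≤1+N)) ⟩
      N ∸ i     ∎)
      where
      open ≤-Reasoning
      2+i≤j : suc (suc i) ≤ j
      2+i≤j = ≤-trans (s≤s i<P) P<j

  rank-injective : ∀ {i j} → i ≤ suc N → j ≤ suc N → i ≢ P → j ≢ P → rank i ≡ rank j → i ≡ j
  rank-injective {i} {j} i≤ j≤ i≢P j≢P eq with i <? P | j <? P
  ... | yes i<P | yes j<P = ∸-cancelˡ-≡ (s≤s⁻¹ (≤-trans i<P P≤1+N)) (s≤s⁻¹ (≤-trans j<P P≤1+N)) eq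
  ... | no  _   | no  _   = ∸-cancelˡ-≡ i≤ j≤ eq
  ... | yes i<P | no  j≮P = contradiction eq (before≢after i<P (≤∧≢⇒< (≮⇒≥ j≮P) (j≢P ∘ sym)) j≤)
  ... | no  i≮P | yes j<P = contradiction (sym eq) (before≢after j<P (≤∧≢⇒< (≮⇒≥ i≮P) (i≢P ∘ sym)) i≤)

  rank-suc : ∀ {w} → suc w ≢ P → suc w ≤ suc N → rank w ≡ suc (rank (suc w))
  rank-suc {w} 1+w≢P 1+w≤1+N with w <? P | suc w <? P
  ... | yes _   | yes 1+w<P = +-∸-assoc 1 (s≤s⁻¹ (≤-trans 1+w<P P≤1+N))
  ... | no  _   | no  _     = +-∸-assoc 1 1+w≤1+N
  ... | yes w<P | no  1+w≮P = contradiction (≤-antisym w<P (≮⇒≥ 1+w≮P)) 1+w≢P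
  ... | no  w≮P | yes 1+w<P = contradiction (<-trans (n<1+n w) 1+w<P) w≮P

  -- The label of edge i minus one, as Labeling is 0-based.
  skipLabel : ℕ → ℕ
  skipLabel i = if ⌊ i ≟ P ⌋ then suc N else zigzag N (rank i)

  skipLabel-P : skipLabel P ≡ suc N
  skipLabel-P with P ≟ P
  ... | yes _   = refl
  ... | no  P≢P = contradiction refl P≢P

  skipLabel-≢P : ∀ {i} → i ≢ P → skipLabel i ≡ zigzag N (rank i)
  skipLabel-≢P {i} i≢P with i ≟ P
  ... | yes i≡P = contradiction i≡P i≢P
  ... | no  _   = refl

  skipLabel-≤ : ∀ i → skipLabel i ≤ suc N
  skipLabel-≤ i with i ≟ P
  ... | yes _ = ≤-refl
  ... | no  _ = ≤-trans (zigzag-≤ N (rank i)) (n≤1+n N)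

  skipLabel-injective : ∀ {i j} → i ≤ suc N → j ≤ suc N → skipLabel i ≡ skipLabel j → i ≡ j
  skipLabel-injective {i} {j} i≤ j≤ eq with i ≟ P | j ≟ P
  ... | yes i≡P | yes j≡P = trans i≡P (sym j≡P)
  ... | no  i≢P | no  j≢P = rank-injective i≤ j≤ i≢P j≢P (zigzag-injective N (rank-≤ i≢P) (rank-≤ j≢P) eq)
  ... | yes _   | no  _   = contradiction (≤-reflexive eq) (<⇒≱ (s≤s (zigzag-≤ N (rank j))))
  ... | no  _   | yes _   = contradiction (≤-reflexive (sym eq)) (<⇒≱ (s≤s (zigzag-≤ N (rank i))))

  skipLabel-pairs : ∀ {w} → w ≢ P → suc w ≢ P → suc w ≤ suc N → skipLabel w ⊕ skipLabel (suc w) ≈ N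
  skipLabel-pairs {w} w≢P 1+w≢P 1+w≤1+N =
    subst₂ (λ a b → a ⊕ b ≈ N)
      (sym (trans (skipLabel-≢P w≢P) (cong (zigzag N) rank-w))) (sym (skipLabel-≢P 1+w≢P))
      (⊕-comm {zigzag N r} (zigzag-pairs N r (subst (_≤ N) rank-w (rank-≤ w≢P))))
    where
    r : ℕ
    r = rank (suc w)
    rank-w : rank w ≡ suc r
    rank-w = rank-suc 1+w≢P 1+w≤1+N

  skipLabel-final : ∃ λ r → r ≤ suc N × skipLabel r ≡ N × (r ≡ suc N ⊎ suc r ≡ P)
  skipLabel-final with P ≟ suc N
  ... | yes P≡1+N =
        N , n≤1+n N , trans (skipLabel-≢P (<⇒≢ N<P)) (cong (zigzag N) (trans (rank-< N<P) (n∸n≡0 N))) ,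
        inj₂ (sym P≡1+N)
    where
    N<P : N < P
    N<P = subst (N <_) (sym P≡1+N) (n<1+n N)
  ... | no  P≢1+N =
        suc N , ≤-refl ,
        trans (skipLabel-≢P (P≢1+N ∘ sym)) (cong (zigzag N) (trans (rank-≮ (≤⇒≯ P≤1+N)) (n∸n≡0 N))) ,
        inj₁ refl

AllFrom : {A : Set} → (ℕ → A → Set) → ℕ → List A → Set
AllFrom P k []       = ⊤
AllFrom P k (x ∷ xs) = P k x × AllFrom P (suc k) xs

AllFrom-++ : ∀ {A : Set} (P : ℕ → A → Set) k xs {ys} →
             AllFrom P k xs → AllFrom P (k + length xs) ys → AllFrom P k (xs ++ ys)
AllFrom-++ P k []       {ys} _            ys-ok = subst (λ j → AllFrom P j ys) (+-identityʳ k) ys-ok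
AllFrom-++ P k (x ∷ xs) {ys} (px , xs-ok) ys-ok =
  px , AllFrom-++ P (suc k) xs xs-ok (subst (λ j → AllFrom P j ys) (+-suc k (length xs)) ys-ok)

AllFrom-lookup : ∀ {A : Set} (P : ℕ → A → Set) k xs → AllFrom P k xs → ∀ i → P (k + toℕ i) (lookup xs i)
AllFrom-lookup P k (x ∷ xs) (px , _)    fzero    = subst (λ j → P j x) (sym (+-identityʳ k)) px
AllFrom-lookup P k (x ∷ xs) (_ , xs-ok) (fsuc i) =
  subst (λ j → P j (lookup xs i)) (sym (+-suc k (toℕ i))) (AllFrom-lookup P (suc k) xs xs-ok i)

legStartFrom : List ℕ → ℕ → ℕ → Bool
legStartFrom []       k i = false
legStartFrom (y ∷ ys) k i = does (i ≟ k) ∨ legStartFrom ys (k + y) i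

legStart : List ℕ → ℕ → Bool
legStart ys = legStartFrom ys 0

legStartFrom-head : ∀ y ys k → legStartFrom (y ∷ ys) k k ≡ true
legStartFrom-head y ys k rewrite dec-true (k ≟ k) refl = refl

legStart-0 : ∀ {ys} → 1 ≤ length ys → legStart ys 0 ≡ true
legStart-0 {y ∷ ys} _ = legStartFrom-head y ys 0

legStartFrom-∷ : ∀ y ys {k i} → legStartFrom ys (k + y) i ≡ true → legStartFrom (y ∷ ys) k i ≡ true
legStartFrom-∷ y ys {k} {i} start = trans (cong (does (i ≟ k) ∨_) start) (∨-zeroʳ _)

legStartFrom-below : ∀ ys {k i} → i < k → legStartFrom ys k i ≡ false
legStartFrom-below []       i<k = refl
legStartFrom-below (y ∷ ys) {k} {i} i<k
  rewrite dec-false (i ≟ k) (<⇒≢ i<k) = legStartFrom-below ys (≤-trans i<k (m≤m+n k y))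

legStartFrom-beyond : ∀ y ys {k i} → k < i → legStartFrom (y ∷ ys) k i ≡ legStartFrom ys (k + y) i
legStartFrom-beyond y ys {k} {i} k<i rewrite dec-false (i ≟ k) (<⇒≢ k<i ∘ sym) = refl

legStartFrom-inside : ∀ y ys {k i} → k < i → i < k + y → legStartFrom (y ∷ ys) k i ≡ false
legStartFrom-inside y ys k<i i<k+y = trans (legStartFrom-beyond y ys k<i) (legStartFrom-below ys i<k+y)

second-legStart : ∀ {ys} → All (1 ≤_) ys → 2 ≤ length ys → ∃ λ i → 0 < i × i < sum ys × legStart ys i ≡ true
second-legStart {y ∷ z ∷ zs} (1≤y ∷ 1≤z ∷ _) _ =
  y , 1≤y , <-≤-trans (m<m+n y 1≤z) (+-monoʳ-≤ y (m≤m+n z (sum zs))) ,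
  trans (legStartFrom-beyond y (z ∷ zs) 1≤y) (legStartFrom-head z zs y)
second-legStart {_ ∷ []} _ (s≤s ())

spiderEdge : (ℕ → Bool) → ℕ → ℕ × ℕ
spiderEdge start i = (if start i then 0 else i) , suc i

EdgesFrom : (ℕ → Bool) → ℕ → List (ℕ × ℕ) → Set
EdgesFrom start = AllFrom (λ i e → e ≡ spiderEdge start i)

length-legEdges : ∀ prev y next → length (legEdges prev y next) ≡ y
length-legEdges prev zero    next = refl
length-legEdges prev (suc y) next = cong suc (length-legEdges next y (suc next))

length-spiderEdges : ∀ ys next → length (spiderEdges ys next) ≡ sum ys
length-spiderEdges []       next = refl
length-spiderEdges (y ∷ ys) next = trans (length-++ (legEdges 0 y next))
  (cong₂ _+_ (length-legEdges 0 y next) (length-spiderEdges ys (next + y)))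

m-spider : ∀ ys → m (spider ys) ≡ sum ys
m-spider ys = length-spiderEdges ys 1

length≤sum : ∀ {ys} → All (1 ≤_) ys → length ys ≤ sum ys
length≤sum []           = z≤n
length≤sum (1≤y ∷ 1≤ys) = +-mono-≤ 1≤y (length≤sum 1≤ys)

legEdges-from : ∀ start y k prev → prev ≡ proj₁ (spiderEdge start k) →
                (∀ j → k < j → j < k + y → start j ≡ false) → EdgesFrom start k (legEdges prev y (suc k))
legEdges-from start zero          k prev prev≡ inner = tt
legEdges-from start (suc zero)    k prev prev≡ inner = cong (_, suc k) prev≡ , tt
legEdges-from start (suc (suc y)) k prev prev≡ inner =
  cong (_, suc k) prev≡ ,
  legEdges-from start (suc y) (suc k) (suc k) (sym parent)
    (λ j k<j j<k+2+y → inner j (<-trans (n<1+n k) k<j) (subst (j <_) k+2+y j<k+2+y))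
  where
  k+2+y : suc (k + suc y) ≡ k + suc (suc y)
  k+2+y = sym (+-suc k (suc y))
  parent : proj₁ (spiderEdge start (suc k)) ≡ suc k
  parent rewrite inner (suc k) (n<1+n k) (subst (suc k <_) k+2+y (s≤s (m<m+n k z<s))) = refl

spiderEdges-from : ∀ ys k → All (1 ≤_) ys → (start : ℕ → Bool) →
                   (∀ i → k ≤ i → start i ≡ legStartFrom ys k i) → EdgesFrom start k (spiderEdges ys (suc k))
spiderEdges-from []       k []           start agrees = tt
spiderEdges-from (y ∷ ys) k (1≤y ∷ 1≤ys) start agrees =
  AllFrom-++ _ k (legEdges 0 y (suc k))
    (legEdges-from start y k 0 (sym root) inner)
    (subst (λ j → EdgesFrom start (k + j) (spiderEdges ys (suc (k + y)))) (sym (length-legEdges 0 y (suc k)))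
      (spiderEdges-from ys (k + y) 1≤ys start later))
  where
  k<k+y : k < k + y
  k<k+y = m<m+n k 1≤y
  root : proj₁ (spiderEdge start k) ≡ 0
  root rewrite agrees k ≤-refl | legStartFrom-head y ys k = refl
  inner : ∀ j → k < j → j < k + y → start j ≡ false
  inner j k<j j<k+y = trans (agrees j (<⇒≤ k<j)) (legStartFrom-inside y ys k<j j<k+y)
  later : ∀ i → k + y ≤ i → start i ≡ legStartFrom ys (k + y) i
  later i k+y≤i =
    trans (agrees i (≤-trans (m≤m+n k y) k+y≤i)) (legStartFrom-beyond y ys (<-≤-trans k<k+y k+y≤i))

spider-ends : ∀ {ys} → All (1 ≤_) ys → ∀ e → ends (spider ys) e ≡ spiderEdge (legStart ys) (toℕ e)
spider-ends {ys} 1≤ys =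
  AllFrom-lookup _ 0 (spiderEdges ys 1) (spiderEdges-from ys 0 1≤ys (legStart ys) (λ _ _ → refl))

legEndsFrom : List ℕ → ℕ → List ℕ
legEndsFrom []       k = []
legEndsFrom (y ∷ ys) k = k + y ∷ legEndsFrom ys (k + y)

legEnds : List ℕ → List ℕ
legEnds ys = legEndsFrom ys 0

-- Vertex v ends a leg iff it is the last vertex or edge v starts the next leg.
IsLeafFrom : List ℕ → ℕ → ℕ → Set
IsLeafFrom ys k v = v ≡ k + sum ys ⊎ legStartFrom ys k v ≡ true

IsLeaf : List ℕ → ℕ → Set
IsLeaf ys = IsLeafFrom ys 0

length-legEndsFrom : ∀ ys k → length (legEndsFrom ys k) ≡ length ys
length-legEndsFrom []       k = refl
length-legEndsFrom (y ∷ ys) k = cong suc (length-legEndsFrom ys (k + y))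

length-map-legEnds : ∀ ys (g : ℕ → ℕ) → length (map g (legEnds ys)) ≡ length ys
length-map-legEnds ys g = trans (length-map g (legEnds ys)) (length-legEndsFrom ys 0)

IsLeafFrom-self : ∀ ys k → IsLeafFrom ys k k
IsLeafFrom-self []       k = inj₁ (sym (+-identityʳ k))
IsLeafFrom-self (y ∷ ys) k = inj₂ (legStartFrom-head y ys k)

IsLeafFrom-∷ : ∀ y ys {k v} → IsLeafFrom ys (k + y) v → IsLeafFrom (y ∷ ys) k v
IsLeafFrom-∷ y ys {k} = Sum.map (λ v≡ → trans v≡ (+-assoc k y (sum ys))) (legStartFrom-∷ y ys)

IsLeafFrom-∷⁻ : ∀ y ys {k v} → k < v → IsLeafFrom (y ∷ ys) k v → IsLeafFrom ys (k + y) v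
IsLeafFrom-∷⁻ y ys {k} k<v =
  Sum.map (λ v≡ → trans v≡ (sym (+-assoc k y (sum ys)))) (trans (sym (legStartFrom-beyond y ys k<v)))

IsLeafFrom⇒≥ : ∀ ys {k v} → IsLeafFrom ys k v → k ≤ v
IsLeafFrom⇒≥ ys {k} (inj₁ refl) = m≤m+n k (sum ys)
IsLeafFrom⇒≥ ys {k} {v} (inj₂ start) =
  ≮⇒≥ (λ v<k → contradiction (trans (sym start) (legStartFrom-below ys v<k)) λ ())

∈-legEndsFrom⁻ : ∀ {ys k v} → All (1 ≤_) ys → v ∈ legEndsFrom ys k →
                 k < v × v ≤ k + sum ys × IsLeafFrom ys k v
∈-legEndsFrom⁻ {y ∷ ys} {k} (1≤y ∷ 1≤ys) (here refl) =
  m<m+n k 1≤y , +-monoʳ-≤ k (m≤m+n y (sum ys)) , IsLeafFrom-∷ y ys (IsLeafFrom-self ys (k + y))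
∈-legEndsFrom⁻ {y ∷ ys} {k} (1≤y ∷ 1≤ys) (there v∈) with k+y<v , v≤ , leaf ← ∈-legEndsFrom⁻ 1≤ys v∈ =
  ≤-trans (s≤s (m≤m+n k y)) k+y<v , ≤-trans v≤ (≤-reflexive (+-assoc k y (sum ys))) , IsLeafFrom-∷ y ys leaf

∈-legEndsFrom⁺ : ∀ {ys k v} → All (1 ≤_) ys → k < v → v ≤ k + sum ys → IsLeafFrom ys k v → v ∈ legEndsFrom ys k
∈-legEndsFrom⁺ {[]}     {k} []           k<v v≤k+0 _ =
  contradiction (≤-trans v≤k+0 (≤-reflexive (+-identityʳ k))) (<⇒≱ k<v)
∈-legEndsFrom⁺ {y ∷ ys} {k} {v} (1≤y ∷ 1≤ys) k<v v≤ leaf with v ≟ k + y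
... | yes v≡k+y = here v≡k+y
... | no  v≢k+y =
      there (∈-legEndsFrom⁺ 1≤ys (≤∧≢⇒< (IsLeafFrom⇒≥ ys leaf′) (v≢k+y ∘ sym))
                                  (≤-trans v≤ (≤-reflexive (sym (+-assoc k y (sum ys))))) leaf′)
  where
  leaf′ : IsLeafFrom ys (k + y) v
  leaf′ = IsLeafFrom-∷⁻ y ys k<v leaf

legEndsFrom-unique : ∀ {ys} k → All (1 ≤_) ys → Unique (legEndsFrom ys k)
legEndsFrom-unique {[]}     k []         = []
legEndsFrom-unique {y ∷ ys} k (_ ∷ 1≤ys) =
  All.tabulate (λ v∈ → <⇒≢ (proj₁ (∈-legEndsFrom⁻ 1≤ys v∈))) ∷ legEndsFrom-unique (k + y) 1≤ys

pendant-edge-from : ∀ {ys} k → All (1 ≤_) ys → 1 ∈ ys →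
                    ∃ λ p → legStartFrom ys k p ≡ true × suc p ≤ k + sum ys × IsLeafFrom ys k (suc p)
pendant-edge-from {.1 ∷ ys} k _ (here refl) =
  k , legStartFrom-head 1 ys k , ≤-trans (s≤s (m≤m+n k (sum ys))) (≤-reflexive (sym (+-suc k (sum ys)))) ,
  subst (IsLeafFrom (1 ∷ ys) k) (+-comm k 1) (IsLeafFrom-∷ 1 ys (IsLeafFrom-self ys (k + 1)))
pendant-edge-from {y ∷ ys} k (_ ∷ 1≤ys) (there 1∈ys)
  with p , start , bound , leaf ← pendant-edge-from (k + y) 1≤ys 1∈ys =
  p , legStartFrom-∷ y ys start , ≤-trans bound (≤-reflexive (+-assoc k y (sum ys))) , IsLeafFrom-∷ y ys leaf

module SpiderSums {ys : List ℕ} (1≤ys : All (1 ≤_) ys) (f : Labeling (spider ys)) where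

  G : Graph
  G = spider ys

  L : Fin (m G) → ℕ
  L = label G f

  start : ℕ → Bool
  start = legStart ys

  toℕ<sum : ∀ (e : Fin (m G)) → toℕ e < sum ys
  toℕ<sum e = subst (toℕ e <_) (m-spider ys) (Fin.toℕ<n e)

  edgeAt : ∀ {i} → i < sum ys → Fin (m G)
  edgeAt i<q = fromℕ< (subst (_ <_) (sym (m-spider ys)) i<q)

  toℕ-edgeAt : ∀ {i} (i<q : i < sum ys) → toℕ (edgeAt i<q) ≡ i
  toℕ-edgeAt i<q = Fin.toℕ-fromℕ< _

  spider-incident : ∀ {e v} → Incident G f e v → (if start (toℕ e) then 0 else toℕ e) ≡ v ⊎ suc (toℕ e) ≡ v
  spider-incident {e} = subst (λ ab → proj₁ ab ≡ _ ⊎ proj₂ ab ≡ _) (spider-ends 1≤ys e)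

  incident-head : ∀ e → Incident G f e (suc (toℕ e))
  incident-head e = inj₂ (cong proj₂ (spider-ends 1≤ys e))

  incident-tail : ∀ e → start (toℕ e) ≡ false → Incident G f e (toℕ e)
  incident-tail e not-start =
    inj₁ (trans (cong proj₁ (spider-ends 1≤ys e)) (cong (λ b → if b then 0 else toℕ e) not-start))

  incident-core : ∀ e → start (toℕ e) ≡ true → Incident G f e 0
  incident-core e is-start =
    inj₁ (trans (cong proj₁ (spider-ends 1≤ys e)) (cong (λ b → if b then 0 else toℕ e) is-start))

  incident-suc⁻ : ∀ {e v} → Incident G f e (suc v) → toℕ e ≡ v ⊎ (toℕ e ≡ suc v × start (suc v) ≡ false)
  incident-suc⁻ {e} inc with spider-incident inc
  ... | inj₂ eq     = inj₁ (suc-injective eq)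
  ... | inj₁ parent with start (toℕ e) in not-start
  ...   | true  = contradiction parent λ ()
  ...   | false = inj₂ (parent , subst (λ i → start i ≡ false) parent not-start)

  vsum-leaf : ∀ e → IsLeaf ys (suc (toℕ e)) → vsum G f (suc (toℕ e)) ≡ L e
  vsum-leaf e leaf = vsum≡label G f (incident-head e) only-e
    where
    only-e : ∀ e′ → Incident G f e′ (suc (toℕ e)) → e′ ≡ e
    only-e e′ inc with incident-suc⁻ inc
    ... | inj₁ eq               = Fin.toℕ-injective eq
    ... | inj₂ (eq , not-start) =
          ⊥-elim ([ (λ at-end → <⇒≢ (toℕ<sum e′) (trans eq at-end))
                  , (λ start′ → contradiction (trans (sym start′) not-start) λ ()) ] leaf)

  vsum-leaf-at : ∀ {w} (w<q : w < sum ys) → IsLeaf ys (suc w) → vsum G f (suc w) ≡ L (edgeAt w<q)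
  vsum-leaf-at w<q leaf = subst (λ i → vsum G f (suc i) ≡ L (edgeAt w<q)) (toℕ-edgeAt w<q)
    (vsum-leaf (edgeAt w<q) (subst (IsLeaf ys ∘ suc) (sym (toℕ-edgeAt w<q)) leaf))

  vsum-internal : ∀ e e′ → toℕ e′ ≡ suc (toℕ e) → start (toℕ e′) ≡ false → vsum G f (toℕ e′) ≡ L e + L e′
  vsum-internal e e′ e′-next not-start =
    vsum≡label+label G f e≢e′ (subst (Incident G f e) (sym e′-next) (incident-head e)) (incident-tail e′ not-start)
      only
    where
    e≢e′ : e ≢ e′
    e≢e′ e≡e′ = <⇒≢ (n<1+n (toℕ e)) (trans (cong toℕ e≡e′) e′-next)
    only : ∀ e″ → Incident G f e″ (toℕ e′) → e″ ≡ e ⊎ e″ ≡ e′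
    only e″ inc with incident-suc⁻ (subst (Incident G f e″) e′-next inc)
    ... | inj₁ eq       = inj₁ (Fin.toℕ-injective eq)
    ... | inj₂ (eq , _) = inj₂ (Fin.toℕ-injective (trans eq (sym e′-next)))

  predecessor : 1 ≤ length ys → ∀ e → start (toℕ e) ≡ false → ∃ λ e₀ → toℕ e ≡ suc (toℕ e₀)
  predecessor 1≤d e not-start with toℕ e in eq
  ... | zero  = contradiction (trans (sym (legStart-0 {ys} 1≤d)) not-start) λ ()
  ... | suc w = edgeAt w<q , cong suc (sym (toℕ-edgeAt w<q))
    where
    w<q : w < sum ys
    w<q = <-trans (n<1+n w) (subst (_< sum ys) eq (toℕ<sum e))

  leaf-or-internal : ∀ e → IsLeaf ys (suc (toℕ e)) ⊎ ∃ λ e₂ → toℕ e₂ ≡ suc (toℕ e) × start (toℕ e₂) ≡ false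
  leaf-or-internal e with suc (toℕ e) ≟ sum ys | start (suc (toℕ e)) Bool.≟ true
  ... | yes at-end | _             = inj₁ (inj₁ at-end)
  ... | no  _      | yes start-1+e = inj₁ (inj₂ start-1+e)
  ... | no  ¬end   | no  ¬start    =
        inj₂ (edgeAt next<q , toℕ-edgeAt next<q , trans (cong start (toℕ-edgeAt next<q)) (¬-not ¬start))
    where
    next<q : suc (toℕ e) < sum ys
    next<q = ≤∧≢⇒< (toℕ<sum e) ¬end

  another-start-edge : 2 ≤ length ys → ∀ e → ∃ λ e′ → e′ ≢ e × start (toℕ e′) ≡ true
  another-start-edge 2≤d e with second-legStart 1≤ys 2≤d | toℕ e ≟ 0
  ... | i , 0<i , i<q , start-i | yes e≡0 =
        edgeAt i<q , (λ eq → <⇒≢ 0<i (sym (trans (sym (toℕ-edgeAt i<q)) (trans (cong toℕ eq) e≡0)))) ,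
        trans (cong start (toℕ-edgeAt i<q)) start-i
  ... | i , 0<i , i<q , _       | no  e≢0 =
        edgeAt 0<q , (λ eq → e≢0 (trans (cong toℕ (sym eq)) (toℕ-edgeAt 0<q))) ,
        trans (cong start (toℕ-edgeAt 0<q)) (legStart-0 {ys} (≤-trans (s≤s z≤n) 2≤d))
    where
    0<q : 0 < sum ys
    0<q = <-trans 0<i i<q

  label<vsum-core : 2 ≤ length ys → ∀ e → start (toℕ e) ≡ true → L e < vsum G f 0
  label<vsum-core 2≤d e start-e with e′ , e′≢e , start-e′ ← another-start-edge 2≤d e =
    <-≤-trans (m<m+n (L e) z<s)
      (label+label≤vsum G f (e′≢e ∘ sym) (incident-core e start-e) (incident-core e′ start-e′))

  leaf-label : ∀ {v} → v ∈ legEnds ys → ∃ λ e → suc (toℕ e) ≡ v × vsum G f v ≡ L e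
  leaf-label v∈ with ∈-legEndsFrom⁻ 1≤ys v∈
  ... | s≤s {n = w} _ , w<q , leaf = edgeAt w<q , cong suc (toℕ-edgeAt w<q) , vsum-leaf-at w<q leaf

  -- Inside a leg the sums at i and i + 1 share the label of edge i, so they differ by injectivity.
  proper-if-core-heaviest : 1 ≤ length ys → Injective _≡_ _≡_ f → (∀ e → vsum G f (suc (toℕ e)) < vsum G f 0) →
                            ∀ e → vsum G f (proj₁ (ends G e)) ≢ vsum G f (proj₂ (ends G e))
  proper-if-core-heaviest 1≤d f-injective core-heaviest e
    rewrite spider-ends 1≤ys e with start (toℕ e) Bool.≟ true
  ... | yes start-e rewrite start-e = >⇒≢ (core-heaviest e)
  ... | no  ¬start  rewrite ¬-not ¬start with predecessor 1≤d e (¬-not ¬start) | leaf-or-internal e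
  ...   | e₀ , e-next | inj₁ leaf = λ eq →
          <⇒≢ (m<n+m (L e) z<s) (trans (sym (vsum-leaf e leaf)) (trans (sym eq) vsum-e))
    where
    vsum-e : vsum G f (toℕ e) ≡ L e₀ + L e
    vsum-e = vsum-internal e₀ e e-next (¬-not ¬start)
  ...   | e₀ , e-next | inj₂ (e₂ , e₂-next , ¬start₂) = λ eq →
          <⇒≢ (<-trans (n<1+n _) (n<1+n _)) (trans (cong toℕ (e₀≡e₂ eq)) (trans e₂-next (cong suc e-next)))
    where
    e₀≡e₂ : vsum G f (toℕ e) ≡ vsum G f (suc (toℕ e)) → e₀ ≡ e₂
    e₀≡e₂ eq = label-injective G f f-injective (+-cancelʳ-≡ (L e) (L e₀) (L e₂) (begin
      L e₀ + L e             ≡⟨ vsum-internal e₀ e e-next (¬-not ¬start) ⟨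
      vsum G f (toℕ e)       ≡⟨ eq ⟩
      vsum G f (suc (toℕ e)) ≡⟨ cong (vsum G f) e₂-next ⟨
      vsum G f (toℕ e₂)      ≡⟨ vsum-internal e e₂ e₂-next ¬start₂ ⟩
      L e + L e₂             ≡⟨ +-comm (L e) (L e₂) ⟩
      L e₂ + L e             ∎))
      where open ≡-Reasoning

-- Lower bound

module LowerBound {ys : List ℕ} (1≤ys : All (1 ≤_) ys) (2≤d : 2 ≤ length ys)
                  (f : Labeling (spider ys)) (f-bijective : Bijective _≡_ _≡_ f) where

  open SpiderSums 1≤ys f

  1≤d : 1 ≤ length ys
  1≤d = ≤-trans (s≤s z≤n) 2≤d

  0<m : 0 < m G
  0<m = subst (0 <_) (sym (m-spider ys)) (≤-trans 1≤d (length≤sum 1≤ys))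

  -- The edge labelled m G lies at the core or at an internal vertex.
  heavy-vertex : ∃ λ v → v < n G × m G < vsum G f v
  heavy-vertex with e* , top ← surjective-hits-top f (proj₂ f-bijective) 0<m | start (toℕ e*) Bool.≟ true
  ... | yes start-e* = 0 , z<s , subst (_< vsum G f 0) top (label<vsum-core 2≤d e* start-e*)
  ... | no  ¬start with e₀ , e*-next ← predecessor 1≤d e* (¬-not ¬start) =
        toℕ e* , s≤s (<⇒≤ (toℕ<sum e*)) ,
        subst₂ _<_ top (sym (vsum-internal e₀ e* e*-next (¬-not ¬start))) (m<n+m (L e*) z<s)

  leaf-vsum-≤ : ∀ {v} → v ∈ legEnds ys → vsum G f v ≤ m G
  leaf-vsum-≤ v∈ with e , _ , vs≡ ← leaf-label v∈ = subst (_≤ m G) (sym vs≡) (Fin.toℕ<n (f e))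

  leaf-vsum-injective : ∀ {v w} → v ∈ legEnds ys → w ∈ legEnds ys → vsum G f v ≡ vsum G f w → v ≡ w
  leaf-vsum-injective v∈ w∈ eq with e , refl , vs≡ ← leaf-label v∈ | e′ , refl , vs≡′ ← leaf-label w∈ =
    cong (suc ∘ toℕ) (label-injective G f (proj₁ f-bijective) (trans (sym vs≡) (trans eq vs≡′)))

  legs+1≤numColours : suc (length ys) ≤ numColours G f
  legs+1≤numColours with v , v<n , heavy ← heavy-vertex =
    subst (_≤ numColours G f) (cong suc (length-map-legEnds ys (vsum G f)))
      (length-≤-numColours G f (All.tabulate light ∷ Unique-map⁺ leaf-vsum-injective (legEndsFrom-unique 0 1≤ys))
        ⊆colours)
    where
    light : ∀ {x} → x ∈ map (vsum G f) (legEnds ys) → vsum G f v ≢ x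
    light x∈ eq with w , w∈ , refl ← ∈-map⁻ (vsum G f) x∈ = <⇒≱ heavy (subst (_≤ m G) (sym eq) (leaf-vsum-≤ w∈))
    ⊆colours : vsum G f v ∷ map (vsum G f) (legEnds ys) ⊆ colours G f
    ⊆colours (here refl) = ∈-map⁺ (vsum G f) (∈-upTo⁺ v<n)
    ⊆colours (there x∈) with w , w∈ , refl ← ∈-map⁻ (vsum G f) x∈ =
      ∈-map⁺ (vsum G f) (∈-upTo⁺ (s≤s (proj₁ (proj₂ (∈-legEndsFrom⁻ 1≤ys w∈)))))

-- Upper bound

module UpperBound {ys : List ℕ} (1≤ys : All (1 ≤_) ys) (2≤d : 2 ≤ length ys) {P : ℕ}
                  (start-P : legStart ys P ≡ true) (1+P≤q : suc P ≤ sum ys) (leaf-1+P : IsLeaf ys (suc P)) where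

  q : ℕ
  q = sum ys

  N : ℕ
  N = q ∸ 2

  q≡2+N : q ≡ suc (suc N)
  q≡2+N = sym (trans (+-comm 2 N) (m∸n+n≡m (≤-trans 2≤d (length≤sum 1≤ys))))

  open SkipLabeling N P (s≤s⁻¹ (subst (suc P ≤_) q≡2+N 1+P≤q))

  m≡2+N : m (spider ys) ≡ suc (suc N)
  m≡2+N = trans (m-spider ys) q≡2+N

  labelling : Labeling (spider ys)
  labelling e = fromℕ< (subst (skipLabel (toℕ e) <_) (sym m≡2+N) (s≤s (skipLabel-≤ (toℕ e))))

  open SpiderSums 1≤ys labelling

  vs : ℕ → ℕ
  vs = vsum G labelling

  toℕ-labelling : ∀ e → toℕ (labelling e) ≡ skipLabel (toℕ e)
  toℕ-labelling e = Fin.toℕ-fromℕ< _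

  L≡ : ∀ e → L e ≡ suc (skipLabel (toℕ e))
  L≡ e = cong suc (toℕ-labelling e)

  toℕ≤1+N : ∀ (e : Fin (m G)) → toℕ e ≤ suc N
  toℕ≤1+N e = s≤s⁻¹ (subst (toℕ e <_) m≡2+N (Fin.toℕ<n e))

  labelling-injective : Injective _≡_ _≡_ labelling
  labelling-injective {e} {e′} eq = Fin.toℕ-injective (skipLabel-injective (toℕ≤1+N e) (toℕ≤1+N e′)
    (trans (sym (toℕ-labelling e)) (trans (cong toℕ eq) (toℕ-labelling e′))))

  labelling-bijective : Bijective _≡_ _≡_ labelling
  labelling-bijective = labelling-injective , injective⇒surjective labelling labelling-injective

  P<q : P < q
  P<q = 1+P≤q

  1+N≤q : suc N ≤ q
  1+N≤q = ≤-trans (n≤1+n (suc N)) (≤-reflexive (sym q≡2+N))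

  L-pendant : L (edgeAt P<q) ≡ q
  L-pendant = begin
    L (edgeAt P<q)                    ≡⟨ L≡ (edgeAt P<q) ⟩
    suc (skipLabel (toℕ (edgeAt P<q))) ≡⟨ cong (suc ∘ skipLabel) (toℕ-edgeAt P<q) ⟩
    suc (skipLabel P)                  ≡⟨ cong suc skipLabel-P ⟩
    suc (suc N)                        ≡⟨ q≡2+N ⟨
    q                                  ∎
    where open ≡-Reasoning

  internal-avoids-P : ∀ (e e′ : Fin (m G)) → toℕ e′ ≡ suc (toℕ e) → start (toℕ e′) ≡ false →
                      toℕ e ≢ P × toℕ e′ ≢ P
  internal-avoids-P e e′ e′-next ¬start′ = e≢P , e′≢P
    where
    e′≢P : toℕ e′ ≢ P
    e′≢P eq = contradiction (trans (sym start-P) (trans (cong start (sym eq)) ¬start′)) λ ()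
    e≢P : toℕ e ≢ P
    e≢P eq = [ (λ at-end → <⇒≢ (toℕ<sum e′) (trans e′≡1+P at-end))
             , (λ start-1+P → contradiction (trans (sym start-1+P) (trans (cong start (sym e′≡1+P)) ¬start′)) λ ())
             ] leaf-1+P
      where
      e′≡1+P : toℕ e′ ≡ suc P
      e′≡1+P = trans e′-next (cong suc eq)

  vsum-internal-skipLabel : ∀ (e e′ : Fin (m G)) → toℕ e′ ≡ suc (toℕ e) → start (toℕ e′) ≡ false →
                            vs (toℕ e′) ≡ suc (suc (skipLabel (toℕ e) + skipLabel (suc (toℕ e))))
  vsum-internal-skipLabel e e′ e′-next ¬start′ = begin
    vs (toℕ e′)                                              ≡⟨ vsum-internal e e′ e′-next ¬start′ ⟩
    L e + L e′                                               ≡⟨ cong₂ _+_ (L≡ e) L-e′ ⟩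
    suc (skipLabel (toℕ e)) + suc (skipLabel (suc (toℕ e))) ≡⟨ cong suc (+-suc _ _) ⟩
    suc (suc (skipLabel (toℕ e) + skipLabel (suc (toℕ e))))  ∎
    where
    open ≡-Reasoning
    L-e′ : L e′ ≡ suc (skipLabel (suc (toℕ e)))
    L-e′ = trans (L≡ e′) (cong (suc ∘ skipLabel) e′-next)

  vsum-internal-q-or-1+N : ∀ (e e′ : Fin (m G)) → toℕ e′ ≡ suc (toℕ e) → start (toℕ e′) ≡ false →
                           vs (toℕ e′) ≡ q ⊎ vs (toℕ e′) ≡ suc N
  vsum-internal-q-or-1+N e e′ e′-next ¬start′
    with e≢P , e′≢P ← internal-avoids-P e e′ e′-next ¬start′
    with skipLabel-pairs e≢P (subst (_≢ P) e′-next e′≢P) (subst (_≤ suc N) e′-next (toℕ≤1+N e′))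
  ... | inj₁ pair≡N   = inj₁ (trans vs≡ (trans (cong (suc ∘ suc) pair≡N) (sym q≡2+N)))
    where vs≡ = vsum-internal-skipLabel e e′ e′-next ¬start′
  ... | inj₂ 1+pair≡N = inj₂ (trans vs≡ (cong suc 1+pair≡N))
    where vs≡ = vsum-internal-skipLabel e e′ e′-next ¬start′

  vsum-non-core-≤q : ∀ e → vs (suc (toℕ e)) ≤ q
  vsum-non-core-≤q e with leaf-or-internal e
  ... | inj₁ leaf = subst (_≤ q) (sym (vsum-leaf e leaf)) (subst (L e ≤_) (m-spider ys) (Fin.toℕ<n (labelling e)))
  ... | inj₂ (e₂ , e₂-next , ¬start₂) = subst (_≤ q) (cong vs e₂-next)
          ([ ≤-reflexive , (λ vs≡1+N → subst (_≤ q) (sym vs≡1+N) 1+N≤q) ]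
             (vsum-internal-q-or-1+N e e₂ e₂-next ¬start₂))

  q<vsum-core : q < vs 0
  q<vsum-core =
    subst (_< vs 0) L-pendant (label<vsum-core 2≤d (edgeAt P<q) (trans (cong start (toℕ-edgeAt P<q)) start-P))

  labelling-local-antimagic : IsLocalAntimagic (spider ys) labelling
  labelling-local-antimagic = labelling-bijective ,
    proper-if-core-heaviest (≤-trans (s≤s z≤n) 2≤d) labelling-injective
      (λ e → ≤-<-trans (vsum-non-core-≤q e) q<vsum-core)

  leaf-colour : ∀ {v} → 0 < v → v ≤ q → IsLeaf ys v → vs v ∈ map vs (legEnds ys)
  leaf-colour 0<v v≤q leaf = ∈-map⁺ vs (∈-legEndsFrom⁺ 1≤ys 0<v v≤q leaf)

  q-colour : q ∈ map vs (legEnds ys)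
  q-colour =
    subst (_∈ map vs (legEnds ys)) (trans (vsum-leaf-at P<q leaf-1+P) L-pendant) (leaf-colour z<s 1+P≤q leaf-1+P)

  -- The last edge other than P is labelled q − 1 and ends at a leaf.
  1+N-colour : suc N ∈ map vs (legEnds ys)
  1+N-colour with r , r≤1+N , label-r , r-final ← skipLabel-final =
    subst (_∈ map vs (legEnds ys)) vs≡ (leaf-colour z<s r<q leaf-1+r)
    where
    r<q : r < q
    r<q = subst (r <_) (sym q≡2+N) (s≤s r≤1+N)
    leaf-1+r : IsLeaf ys (suc r)
    leaf-1+r = Sum.map (λ r≡1+N → trans (cong suc r≡1+N) (sym q≡2+N)) (λ 1+r≡P → trans (cong start 1+r≡P) start-P)
                       r-final
    vs≡ : vs (suc r) ≡ suc N
    vs≡ = trans (vsum-leaf-at r<q leaf-1+r)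
                (trans (L≡ _) (cong suc (trans (cong skipLabel (toℕ-edgeAt r<q)) label-r)))

  non-core-colour : ∀ e → vs (suc (toℕ e)) ∈ map vs (legEnds ys)
  non-core-colour e with leaf-or-internal e
  ... | inj₁ leaf = leaf-colour z<s (toℕ<sum e) leaf
  ... | inj₂ (e₂ , e₂-next , ¬start₂) = subst (_∈ map vs (legEnds ys)) (cong vs e₂-next)
          ([ (λ vs≡q   → subst (_∈ map vs (legEnds ys)) (sym vs≡q) q-colour)
           , (λ vs≡1+N → subst (_∈ map vs (legEnds ys)) (sym vs≡1+N) 1+N-colour)
           ] (vsum-internal-q-or-1+N e e₂ e₂-next ¬start₂))

  colours⊆ : colours G labelling ⊆ vs 0 ∷ map vs (legEnds ys)
  colours⊆ x∈ with ∈-map⁻ vs x∈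
  ... | zero  , _    , refl = here refl
  ... | suc w , 1+w∈ , refl =
        there (subst (λ i → vs (suc i) ∈ map vs (legEnds ys)) (toℕ-edgeAt w<q) (non-core-colour (edgeAt w<q)))
    where
    w<q : w < q
    w<q = s≤s⁻¹ (∈-upTo⁻ 1+w∈)

  numColours≤legs+1 : numColours G labelling ≤ suc (length ys)
  numColours≤legs+1 = subst (numColours G labelling ≤_) (cong suc (length-map-legEnds ys vs))
    (numColours-≤-length G labelling colours⊆)

theorem2p3 : (ys : List ℕ) → 3 ≤ length ys → All (1 ≤_) ys → 1 ∈ ys →
    LocalAntimagicChromaticNumber (spider ys) (suc (length ys))
theorem2p3 ys 3≤d 1≤ys 1∈ys with _ , start-P , 1+P≤q , leaf-1+P ← pendant-edge-from 0 1≤ys 1∈ys =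
  let open UpperBound 1≤ys 2≤d start-P 1+P≤q leaf-1+P in
  (labelling , labelling-local-antimagic ,
   ≤-antisym numColours≤legs+1 (legs+1≤numColours labelling labelling-bijective)) ,
  λ f f-local-antimagic → legs+1≤numColours f (proj₁ f-local-antimagic)
  where
  2≤d : 2 ≤ length ys
  2≤d = ≤-trans (n≤1+n 2) 3≤d
  legs+1≤numColours : ∀ f → Bijective _≡_ _≡_ f → suc (length ys) ≤ numColours (spider ys) f
  legs+1≤numColours = LowerBound.legs+1≤numColours 1≤ys 2≤d
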